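{- Let $T$ be a $\Delta(1,2,2)$-free tournament. Suppose there is $x\in V(T)$ such that $T\setminus x$ is a paving tournament and either $d^+(x)\le1$ or $d^-(x)\le1$. Then $T$ is a paving tournament.
   Context: Tournaments are finite; $d^+(x),d^-(x)$ are the out- and in-degree of $x$ in $T$; $T\setminus x$ is $T$ with $x$ deleted. $X\Rightarrow Y$: all edges between disjoint $X,Y$ go from $X$ to $Y$. $\Delta(1,2,2)$: vertices $x,y_1,y_2,z_1,z_2$ with $x\Rightarrow\{y_1,y_2\}\Rightarrow\{z_1,z_2\}\Rightarrow x$ and edges $y_1y_2,z_1z_2$; $T$ is $\Delta(1,2,2)$-free if no induced subtournament is isomorphic to it. For an ordering $\sigma=(v_1,\dots,v_n)$, $B_\sigma(T)$ is the undirected graph on $V(T)$ with edges $v_iv_j$ for $i>j$ and $v_iv_j\in E(T)$. $T$ is a paving tournament if some ordering $\sigma$ satisfies: $v_i,v_{i+1}$ nonadjacent in $B_\sigma(T)$ for all $i\in[n-1]$, and each $v_i$ has at most one $B_\sigma(T)$-neighbour in $\{v_s:s<i\}$ and at most one in $\{v_t:t>i\}$. -}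

module Defs where

open import Data.Nat using (ℕ; suc; _≤_)
open import Data.Fin using (Fin; zero; suc; _<_; toℕ; punchIn)
open import Data.List using (List; length; filter)
open import Data.List.Base using (allFin)
open import Data.Product using (Σ; _×_; _,_)
open import Data.Sum using (_⊎_)
open import Data.Empty using (⊥)
open import Relation.Nullary using (¬_; Dec)
open import Relation.Binary.PropositionalEquality using (_≡_; _≢_)
open import Function.Bundles using (_⤖_; _⇔_; Bijection)
open import Function.Definitions using (Injective)

record Tournament (n : ℕ) : Set₁ where
  field
    E      : Fin n → Fin n → Set
    E?     : ∀ u v → Dec (E u v)
    irrefl : ∀ u → ¬ E u u
    asym   : ∀ u v → E u v → ¬ E v u
    total  : ∀ u v → u ≢ v → E u v ⊎ E v u
open Tournament public

outdeg : ∀ {n} → Tournament n → Fin n → ℕ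
outdeg T x = length (filter (λ y → E? T x y) (allFin _))

indeg : ∀ {n} → Tournament n → Fin n → ℕ
indeg T x = length (filter (λ y → E? T y x) (allFin _))

delete : ∀ {n} → Tournament (suc n) → Fin (suc n) → Tournament n
delete T x = record
  { E      = λ u v → E T (punchIn x u) (punchIn x v)
  ; E?     = λ u v → E? T (punchIn x u) (punchIn x v)
  ; irrefl = λ u → irrefl T (punchIn x u)
  ; asym   = λ u v → asym T (punchIn x u) (punchIn x v)
  ; total  = λ u v u≢v → total T (punchIn x u) (punchIn x v)
                           (λ eq → u≢v (Data.Fin.Properties.punchIn-injective x u v eq))
  }
  where import Data.Fin.Properties

-- Δ(1,2,2) on Fin 5: 0 = x, 1 = y₁, 2 = y₂, 3 = z₁, 4 = z₂.
-- x ⇒ {y₁,y₂} ⇒ {z₁,z₂} ⇒ x, plus y₁ → y₂ and z₁ → z₂.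
data Δ122 : Fin 5 → Fin 5 → Set where
  x→y₁  : Δ122 zero (suc zero)
  x→y₂  : Δ122 zero (suc (suc zero))
  y₁→z₁ : Δ122 (suc zero) (suc (suc (suc zero)))
  y₁→z₂ : Δ122 (suc zero) (suc (suc (suc (suc zero))))
  y₂→z₁ : Δ122 (suc (suc zero)) (suc (suc (suc zero)))
  y₂→z₂ : Δ122 (suc (suc zero)) (suc (suc (suc (suc zero))))
  z₁→x  : Δ122 (suc (suc (suc zero))) zero
  z₂→x  : Δ122 (suc (suc (suc (suc zero)))) zero
  y₁→y₂ : Δ122 (suc zero) (suc (suc zero))
  z₁→z₂ : Δ122 (suc (suc (suc zero))) (suc (suc (suc (suc zero))))

HasInducedΔ122 : ∀ {n} → Tournament n → Set
HasInducedΔ122 {n} T =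
  Σ (Fin 5 → Fin n) λ f → Injective _≡_ _≡_ f × (∀ i j → E T (f i) (f j) ⇔ Δ122 i j)

Δ122-free : ∀ {n} → Tournament n → Set
Δ122-free T = ¬ HasInducedΔ122 T

-- An ordering σ = (v₁,…,vₙ) is a bijection from positions to vertices (v_i = σ i).
-- B_σ(T) has edge v_i v_j (i > j) iff v_i → v_j in T.
Bback : ∀ {n} → Tournament n → (Fin n → Fin n) → Fin n → Fin n → Set
Bback T σ i j = j < i × E T (σ i) (σ j)

Badj : ∀ {n} → Tournament n → (Fin n → Fin n) → Fin n → Fin n → Set
Badj T σ i j = Bback T σ i j ⊎ Bback T σ j i

AtMostOne : ∀ {n} → (Fin n → Set) → Set
AtMostOne P = ∀ a b → P a → P b → a ≡ b

IsPavingOrdering : ∀ {n} → Tournament n → (Fin n ⤖ Fin n) → Set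
IsPavingOrdering {n} T σ =
    (∀ i j → toℕ j ≡ suc (toℕ i) → ¬ Badj T f i j)
  × (∀ i → AtMostOne (λ s → Bback T f i s))
  × (∀ i → AtMostOne (λ t → Bback T f t i))
  where f = Bijection.to σ

IsPaving : ∀ {n} → Tournament n → Set
IsPaving {n} T = Σ (Fin n ⤖ Fin n) λ σ → IsPavingOrdering T σ

{-# OPTIONS --safe #-}
module Submission where

open import Defs
open import Data.Nat using (ℕ; suc; _≤_)
open import Data.Fin using (Fin)
open import Data.Sum using (_⊎_)

open import Data.Nat using (_+_; _∸_; _<_; z≤n; s≤s; _<?_)
import Data.Nat.Properties as ℕ
open import Data.Fin using (toℕ; fromℕ<; punchIn; punchOut)
import Data.Fin.Properties as Fin
open import Data.Fin.Patterns using (0F; 1F; 2F; 3F; 4F)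
open import Data.Vec using (_∷_; []; lookup)
open import Data.Vec.Functional using (insertAt)
open import Data.Vec.Functional.Properties using (insertAt-lookup; insertAt-punchIn)
open import Data.List using (List; []; _∷_; length; filter)
open import Data.List.Base using (allFin)
open import Data.List.Membership.Propositional using (_∈_)
open import Data.List.Membership.Propositional.Properties using (∈-filter⁺; ∈-allFin)
open import Data.List.Relation.Unary.Any using (here; there; any?)
open import Data.List.Relation.Unary.All as All using (All; _∷_; [])
open import Data.Product using (∃; _×_; _,_; proj₁; proj₂)
open import Data.Product.Properties using (≡-dec)
open import Data.Sum using (inj₁; inj₂)
open import Data.Unit using (⊤; tt)
open import Data.Empty using (⊥; ⊥-elim)
open import Function using (_∘_; _∘′_)
open import Function.Bundles using (_⤖_; Bijection; mk⤖; mk⇔; Equivalence)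
open import Function.Definitions using (Injective)
open import Relation.Nullary using (¬_; Dec; yes; no; contradiction; ¬?)
open import Relation.Nullary.Decidable using (from-yes; map′; _×-dec_; _⊎-dec_; _→-dec_)
open import Relation.Unary using (Decidable)
open import Relation.Binary.PropositionalEquality
open import Relation.Binary.Definitions using (tri<; tri≈; tri>)

-- It suffices to treat d⁺(x) ≤ 1: the converse of Δ(1,2,2) is again Δ(1,2,2), and
-- reversing a paving ordering of T gives one of the converse of T. Orderings are handled through
-- ranks ρ, the edges of B_σ(T) being the back edges a → b with ρ b < ρ a. If x has no out-neighbour
-- it goes last. Otherwise x → w and every other vertex beats x, so Δ(1,2,2)-freeness of T allows,
-- for each u → w, at most one z with w → z → u. Putting x last creates the single back edge x → w,
-- which is harmless once w is not last and has no back edge from a later vertex; if w is last, x goes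
-- just before it. A back edge u → w from a later u forces every vertex ranked between them to be
-- such a z, so w, y, u sit at consecutive ranks and form a cyclic triangle. Permuting this triangle,
-- together with the back neighbour of y just before or just after it, removes the back edge into w;
-- that y never has back neighbours on both sides is again Δ(1,2,2)-freeness.

-- Paving rankings

Back : ∀ {n} → Tournament n → (Fin n → ℕ) → Fin n → Fin n → Set
Back T ρ a b = ρ b < ρ a × E T a b

record IsRanking {n} (ρ : Fin n → ℕ) : Set where
  field
    bounded   : ∀ v → ρ v < n
    injective : Injective _≡_ _≡_ ρ

record IsPavingRanking {n} (T : Tournament n) (ρ : Fin n → ℕ) : Set where
  field
    isRanking            : IsRanking ρ
    back-not-consecutive : ∀ a b → ρ b ≡ suc (ρ a) → ¬ E T b a
    back-target-unique   : ∀ a → AtMostOne (Back T ρ a)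
    back-source-unique   : ∀ b → AtMostOne (λ a → Back T ρ a b)
  open IsRanking isRanking public

NoLaterBackSource : ∀ {n} → Tournament n → (Fin n → ℕ) → Fin n → Set
NoLaterBackSource T ρ b = ∀ c → ¬ Back T ρ c b

back? : ∀ {n} (T : Tournament n) (ρ : Fin n → ℕ) a b → Dec (Back T ρ a b)
back? T ρ a b = (ρ b <? ρ a) ×-dec E? T a b

forward : ∀ {n} (T : Tournament n) (ρ : Fin n → ℕ) {a b} → ρ a < ρ b → ¬ E T b a → E T a b
forward T ρ {a} {b} l ¬ba with total T a b (λ a≡b → ℕ.<-irrefl (cong ρ a≡b) l)
... | inj₁ ab = ab
... | inj₂ ba = ⊥-elim (¬ba ba)

Fin-injective⇒surjective : ∀ {m} (f : Fin m → Fin m) → Injective _≡_ _≡_ f → ∀ p → ∃ λ a → f a ≡ p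
Fin-injective⇒surjective {m} f f-injective p with Fin.any? (λ a → f a Fin.≟ p)
... | yes hit = hit
Fin-injective⇒surjective {suc m} f f-injective p | no miss =
  ⊥-elim (ℕ.<-irrefl refl (Fin.injective⇒≤ squeeze-injective))
  where
  p≢f : ∀ a → p ≢ f a
  p≢f a eq = miss (a , sym eq)
  squeeze : Fin (suc m) → Fin m
  squeeze a = punchOut (p≢f a)
  squeeze-injective : Injective _≡_ _≡_ squeeze
  squeeze-injective eq = f-injective (Fin.punchOut-injective (p≢f _) (p≢f _) eq)

rank-surjective : ∀ {n} {ρ : Fin n → ℕ} → IsRanking ρ → ∀ r → r < n → ∃ λ v → ρ v ≡ r
rank-surjective {n} {ρ} ranking r r<n =
  let v , eq = Fin-injective⇒surjective slot slot-injective (fromℕ< r<n)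
  in v , trans (sym (toℕ-slot v)) (trans (cong toℕ eq) (Fin.toℕ-fromℕ< r<n))
  where
  open IsRanking ranking
  slot : Fin n → Fin n
  slot v = fromℕ< (bounded v)
  toℕ-slot : ∀ v → toℕ (slot v) ≡ ρ v
  toℕ-slot v = Fin.toℕ-fromℕ< (bounded v)
  slot-injective : Injective _≡_ _≡_ slot
  slot-injective {a} {b} eq = injective (trans (sym (toℕ-slot a)) (trans (cong toℕ eq) (toℕ-slot b)))

paving⇒ranking : ∀ {n} {T : Tournament n} → IsPaving T → ∃ (IsPavingRanking T)
paving⇒ranking {n} {T} (σ , consecutive , targets , sources) = ρ , record
  { isRanking = record { bounded = λ v → Fin.toℕ<n (position v) ; injective = injective }
  ; back-not-consecutive = λ a b eq ba →
      consecutive (position a) (position b) eq (inj₂ (ℕ.≤-reflexive (sym eq) , on-vertices ba))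
  ; back-target-unique = λ a _ _ ab₁ ab₂ →
      position-injective (targets (position a) _ _ (as-B-edge ab₁) (as-B-edge ab₂))
  ; back-source-unique = λ b _ _ a₁b a₂b →
      position-injective (sources (position b) _ _ (as-B-edge a₁b) (as-B-edge a₂b))
  }
  where
  at : Fin n → Fin n
  at = Bijection.to σ
  position : Fin n → Fin n
  position v = proj₁ (Bijection.surjective σ v)
  at-position : ∀ v → at (position v) ≡ v
  at-position v = proj₂ (Bijection.surjective σ v) refl
  position-injective : ∀ {a b} → position a ≡ position b → a ≡ b
  position-injective {a} {b} eq = trans (sym (at-position a)) (trans (cong at eq) (at-position b))
  ρ : Fin n → ℕ
  ρ v = toℕ (position v)
  injective : Injective _≡_ _≡_ ρ
  injective eq = position-injective (Fin.toℕ-injective eq)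
  on-vertices : ∀ {a b} → E T a b → E T (at (position a)) (at (position b))
  on-vertices {a} {b} = subst₂ (E T) (sym (at-position a)) (sym (at-position b))
  as-B-edge : ∀ {a b} → Back T ρ a b → Bback T at (position a) (position b)
  as-B-edge (l , e) = l , on-vertices e

ranking⇒paving : ∀ {n} {T : Tournament n} {ρ} → IsPavingRanking T ρ → IsPaving T
ranking⇒paving {n} {T} {ρ} paving = σ , consecutive , targets , sources
  where
  open IsPavingRanking paving
  at : Fin n → Fin n
  at p = proj₁ (rank-surjective isRanking (toℕ p) (Fin.toℕ<n p))
  ρ-at : ∀ p → ρ (at p) ≡ toℕ p
  ρ-at p = proj₂ (rank-surjective isRanking (toℕ p) (Fin.toℕ<n p))
  at-injective : Injective _≡_ _≡_ at
  at-injective {p} {q} eq = Fin.toℕ-injective (trans (sym (ρ-at p)) (trans (cong ρ eq) (ρ-at q)))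
  σ : Fin n ⤖ Fin n
  σ = mk⤖ (at-injective , λ v → fromℕ< (bounded v) , λ { refl →
        injective (trans (ρ-at _) (Fin.toℕ-fromℕ< (bounded v))) })
  as-back : ∀ {p q} → Bback T at p q → Back T ρ (at p) (at q)
  as-back {p} {q} (q<p , e) = subst₂ _<_ (sym (ρ-at q)) (sym (ρ-at p)) q<p , e
  consecutive : ∀ p q → toℕ q ≡ suc (toℕ p) → ¬ Badj T at p q
  consecutive p q eq (inj₁ (q<p , _)) = ℕ.<-asym q<p (ℕ.≤-reflexive (sym eq))
  consecutive p q eq (inj₂ (_ , e)) =
    back-not-consecutive (at p) (at q) (trans (ρ-at q) (trans eq (cong suc (sym (ρ-at p))))) e
  targets : ∀ p → AtMostOne (Bback T at p)
  targets p _ _ pq₁ pq₂ = at-injective (back-target-unique (at p) _ _ (as-back pq₁) (as-back pq₂))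
  sources : ∀ q → AtMostOne (λ p → Bback T at p q)
  sources q _ _ p₁q p₂q = at-injective (back-source-unique (at q) _ _ (as-back p₁q) (as-back p₂q))

-- Converse tournaments and copies of Δ(1,2,2)

converse : ∀ {n} → Tournament n → Tournament n
converse T = record
  { E = λ a b → E T b a ; E? = λ a b → E? T b a ; irrefl = irrefl T
  ; asym = λ a b → asym T b a ; total = λ a b a≢b → total T b a (a≢b ∘′ sym) }

module _ {n} {T : Tournament n} {ρ : Fin n → ℕ} (paving : IsPavingRanking T ρ) where
  open IsPavingRanking paving

  private
    ρᶜ : Fin n → ℕ
    ρᶜ v = n ∸ suc (ρ v)

    reflects-< : ∀ {a b} → ρᶜ b < ρᶜ a → ρ a < ρ b
    reflects-< l = ℕ.≤-pred (ℕ.∸-cancelʳ-< {o = n} l)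

    reflects-consecutive : ∀ {a b} → ρᶜ b ≡ suc (ρᶜ a) → ρ a ≡ suc (ρ b)
    reflects-consecutive {a} {b} eq = sym (ℕ.∸-cancelˡ-≡ (bounded b) (ℕ.<⇒≤ (bounded a))
      (trans eq (sym (ℕ.+-∸-assoc 1 (bounded a)))))

  converse-ranking : IsPavingRanking (converse T) (λ v → n ∸ suc (ρ v))
  converse-ranking = record
    { isRanking = record
      { bounded = λ v → ℕ.∸-monoʳ-< (s≤s z≤n) (bounded v)
      ; injective = λ {a} {b} eq →
          injective (ℕ.suc-injective (ℕ.∸-cancelˡ-≡ (bounded a) (bounded b) eq)) }
    ; back-not-consecutive = λ a b eq → back-not-consecutive b a (reflects-consecutive eq)
    ; back-target-unique = λ a b₁ b₂ (l₁ , e₁) (l₂ , e₂) →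
        back-source-unique a b₁ b₂ (reflects-< l₁ , e₁) (reflects-< l₂ , e₂)
    ; back-source-unique = λ b a₁ a₂ (l₁ , e₁) (l₂ , e₂) →
        back-target-unique b a₁ a₂ (reflects-< l₁ , e₁) (reflects-< l₂ , e₂)
    }

converse-paving : ∀ {n} (T : Tournament n) → IsPaving T → IsPaving (converse T)
converse-paving T P = ranking⇒paving (converse-ranking {T = T} (proj₂ (paving⇒ranking P)))

Δ122-trichotomous : ∀ i j → i ≡ j ⊎ Δ122 i j ⊎ Δ122 j i
Δ122-trichotomous 0F 0F = inj₁ refl
Δ122-trichotomous 0F 1F = inj₂ (inj₁ x→y₁)
Δ122-trichotomous 0F 2F = inj₂ (inj₁ x→y₂)
Δ122-trichotomous 0F 3F = inj₂ (inj₂ z₁→x)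
Δ122-trichotomous 0F 4F = inj₂ (inj₂ z₂→x)
Δ122-trichotomous 1F 0F = inj₂ (inj₂ x→y₁)
Δ122-trichotomous 1F 1F = inj₁ refl
Δ122-trichotomous 1F 2F = inj₂ (inj₁ y₁→y₂)
Δ122-trichotomous 1F 3F = inj₂ (inj₁ y₁→z₁)
Δ122-trichotomous 1F 4F = inj₂ (inj₁ y₁→z₂)
Δ122-trichotomous 2F 0F = inj₂ (inj₂ x→y₂)
Δ122-trichotomous 2F 1F = inj₂ (inj₂ y₁→y₂)
Δ122-trichotomous 2F 2F = inj₁ refl
Δ122-trichotomous 2F 3F = inj₂ (inj₁ y₂→z₁)
Δ122-trichotomous 2F 4F = inj₂ (inj₁ y₂→z₂)
Δ122-trichotomous 3F 0F = inj₂ (inj₁ z₁→x)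
Δ122-trichotomous 3F 1F = inj₂ (inj₂ y₁→z₁)
Δ122-trichotomous 3F 2F = inj₂ (inj₂ y₂→z₁)
Δ122-trichotomous 3F 3F = inj₁ refl
Δ122-trichotomous 3F 4F = inj₂ (inj₁ z₁→z₂)
Δ122-trichotomous 4F 0F = inj₂ (inj₁ z₂→x)
Δ122-trichotomous 4F 1F = inj₂ (inj₂ y₁→z₂)
Δ122-trichotomous 4F 2F = inj₂ (inj₂ y₂→z₂)
Δ122-trichotomous 4F 3F = inj₂ (inj₂ z₁→z₂)
Δ122-trichotomous 4F 4F = inj₁ refl

module _ {n} (T : Tournament n) {x y₁ y₂ z₁ z₂ : Fin n}
  (xy₁ : E T x y₁) (xy₂ : E T x y₂) (y₁z₁ : E T y₁ z₁) (y₁z₂ : E T y₁ z₂) (y₂z₁ : E T y₂ z₁)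
  (y₂z₂ : E T y₂ z₂) (z₁x : E T z₁ x) (z₂x : E T z₂ x) (y₁y₂ : E T y₁ y₂) (z₁z₂ : E T z₁ z₂) where

  private
    f : Fin 5 → Fin n
    f 0F = x
    f 1F = y₁
    f 2F = y₂
    f 3F = z₁
    f 4F = z₂

    edge : ∀ {i j} → Δ122 i j → E T (f i) (f j)
    edge x→y₁  = xy₁
    edge x→y₂  = xy₂
    edge y₁→z₁ = y₁z₁
    edge y₁→z₂ = y₁z₂
    edge y₂→z₁ = y₂z₁
    edge y₂→z₂ = y₂z₂
    edge z₁→x  = z₁x
    edge z₂→x  = z₂x
    edge y₁→y₂ = y₁y₂
    edge z₁→z₂ = z₁z₂

    f-injective : ∀ {i j} → f i ≡ f j → i ≡ j
    f-injective {i} {j} eq with Δ122-trichotomous i j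
    ... | inj₁ i≡j = i≡j
    ... | inj₂ (inj₁ ij) = ⊥-elim (irrefl T (f j) (subst (λ v → E T v (f j)) eq (edge ij)))
    ... | inj₂ (inj₂ ji) = ⊥-elim (irrefl T (f j) (subst (E T (f j)) eq (edge ji)))

    reflect : ∀ i j → E T (f i) (f j) → Δ122 i j
    reflect i j e with Δ122-trichotomous i j
    ... | inj₁ refl = ⊥-elim (irrefl T _ e)
    ... | inj₂ (inj₁ ij) = ij
    ... | inj₂ (inj₂ ji) = ⊥-elim (asym T _ _ e (edge ji))

  induced-Δ122 : HasInducedΔ122 T
  induced-Δ122 = f , f-injective , λ i j → mk⇔ (reflect i j) edge

converse-Δ122-free : ∀ {n} (T : Tournament n) → Δ122-free T → Δ122-free (converse T)
converse-Δ122-free T free (f , _ , iso) = free (induced-Δ122 T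
  (e z₂→x) (e z₁→x) (e y₂→z₂) (e y₁→z₂) (e y₂→z₁) (e y₁→z₁) (e x→y₂) (e x→y₁) (e z₁→z₂) (e y₁→y₂))
  where
  e : ∀ {i j} → Δ122 i j → E T (f j) (f i)
  e {i} {j} = Equivalence.from (iso i j)

delete-Δ122-free : ∀ {n} (T : Tournament (suc n)) x → Δ122-free T → Δ122-free (delete T x)
delete-Δ122-free T x free (f , f-injective , iso) =
  free (punchIn x ∘ f , f-injective ∘ Fin.punchIn-injective x _ _ , iso)

middle-unique : ∀ {n} (T : Tournament n) → Δ122-free T → ∀ {c z₁ z₂} →
                E T z₁ z₂ → E T z₁ c → E T z₂ c → AtMostOne (λ y → E T c y × E T y z₁ × E T y z₂)
middle-unique T free z₁z₂ z₁c z₂c y₁ y₂ (cy₁ , y₁z₁ , y₁z₂) (cy₂ , y₂z₁ , y₂z₂) with y₁ Fin.≟ y₂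
... | yes y₁≡y₂ = y₁≡y₂
... | no y₁≢y₂ with total T y₁ y₂ y₁≢y₂
...   | inj₁ y₁y₂ = ⊥-elim (free (induced-Δ122 T cy₁ cy₂ y₁z₁ y₁z₂ y₂z₁ y₂z₂ z₁c z₂c y₁y₂ z₁z₂))
...   | inj₂ y₂y₁ = ⊥-elim (free (induced-Δ122 T cy₂ cy₁ y₂z₁ y₂z₂ y₁z₁ y₁z₂ z₁c z₂c y₂y₁ z₁z₂))

-- Inserting a vertex

bump : ℕ → ℕ → ℕ
bump p r with r <? p
... | yes _ = r
... | no _ = suc r

data BumpView (p r b : ℕ) : Set where
  below : r < p → b ≡ r → BumpView p r b
  above : p ≤ r → b ≡ suc r → BumpView p r b

bump-view : ∀ p r → BumpView p r (bump p r)
bump-view p r with r <? p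
... | yes r<p = below r<p refl
... | no r≮p = above (ℕ.≮⇒≥ r≮p) refl

module _ {p : ℕ} where
  bump-mono : ∀ {a b} → a < b → bump p a < bump p b
  bump-mono {a} {b} a<b with bump-view p a | bump-view p b
  ... | below _ ea | below _ eb = subst₂ _<_ (sym ea) (sym eb) a<b
  ... | below _ ea | above _ eb = subst₂ _<_ (sym ea) (sym eb) (ℕ.m<n⇒m<1+n a<b)
  ... | above p≤a _ | below b<p _ = contradiction (ℕ.≤-<-trans p≤a a<b) (ℕ.<-asym b<p)
  ... | above _ ea | above _ eb = subst₂ _<_ (sym ea) (sym eb) (s≤s a<b)

  bump-reflects-< : ∀ {a b} → bump p a < bump p b → a < b
  bump-reflects-< {a} {b} l with ℕ.<-cmp a b
  ... | tri< a<b _ _ = a<b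
  ... | tri≈ _ refl _ = contradiction l (ℕ.<-irrefl refl)
  ... | tri> _ _ b<a = contradiction l (ℕ.<-asym (bump-mono b<a))

  bump-injective : ∀ {a b} → bump p a ≡ bump p b → a ≡ b
  bump-injective {a} {b} eq with ℕ.<-cmp a b
  ... | tri< a<b _ _ = contradiction eq (ℕ.<⇒≢ (bump-mono a<b))
  ... | tri≈ _ a≡b _ = a≡b
  ... | tri> _ _ b<a = contradiction (sym eq) (ℕ.<⇒≢ (bump-mono b<a))

  bump-reflects-consecutive : ∀ {a b} → bump p b ≡ suc (bump p a) → b ≡ suc a
  bump-reflects-consecutive {a} {b} eq with bump-view p a | bump-view p b
  ... | below _ ea | below _ eb = trans (sym eb) (trans eq (cong suc ea))
  ... | below a<p ea | above p≤b eb =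
        contradiction (ℕ.suc-injective (trans (sym eb) (trans eq (cong suc ea))))
                      (ℕ.>⇒≢ (ℕ.<-≤-trans a<p p≤b))
  ... | above p≤a ea | below b<p eb =
        contradiction (trans (sym eb) (trans eq (cong suc ea)))
                      (ℕ.<⇒≢ (ℕ.<-trans b<p (s≤s (ℕ.m≤n⇒m≤1+n p≤a))))
  ... | above _ ea | above _ eb = ℕ.suc-injective (trans (sym eb) (trans eq (cong suc ea)))

  bump-below : ∀ {r} → bump p r < p → r < p
  bump-below {r} l with bump-view p r
  ... | below r<p _ = r<p
  ... | above p≤r eq = contradiction (subst (_< p) eq l) (ℕ.<-asym (s≤s p≤r))

  bump-above : ∀ {r} → p < bump p r → p ≤ r
  bump-above {r} l with bump-view p r
  ... | below r<p eq = contradiction (subst (p <_) eq l) (ℕ.<-asym r<p)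
  ... | above p≤r _ = p≤r

  bump≢p : ∀ r → bump p r ≢ p
  bump≢p r with bump-view p r
  ... | below r<p eq = λ e → ℕ.<⇒≢ r<p (trans (sym eq) e)
  ... | above p≤r eq = λ e → ℕ.<-irrefl (sym (trans (sym eq) e)) (s≤s p≤r)

  bump-just-below : ∀ {r} → suc (bump p r) ≡ p → suc r ≡ p
  bump-just-below {r} e with bump-view p r
  ... | below _ eq = trans (cong suc (sym eq)) e
  ... | above p≤r eq = contradiction (trans (cong suc (sym eq)) e) (ℕ.<⇒≢ (ℕ.m<n⇒m<1+n (s≤s p≤r)) ∘ sym)

  bump-just-above : ∀ {r} → bump p r ≡ suc p → r ≡ p
  bump-just-above {r} e with bump-view p r
  ... | below r<p eq = contradiction (trans (sym eq) e) (ℕ.<⇒≢ (ℕ.m<n⇒m<1+n r<p))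
  ... | above _ eq = ℕ.suc-injective (trans (sym eq) e)

  bump-bounded : ∀ {n r} → p ≤ n → r < n → bump p r < suc n
  bump-bounded {r = r} p≤n r<n with bump-view p r
  ... | below _ eq = subst (_< suc _) (sym eq) (ℕ.m<n⇒m<1+n r<n)
  ... | above _ eq = subst (_< suc _) (sym eq) (s≤s r<n)

data Split {n} (x : Fin (suc n)) : Fin (suc n) → Set where
  inserted : Split x x
  old      : ∀ v → Split x (punchIn x v)

split : ∀ {n} (x t : Fin (suc n)) → Split x t
split x t with x Fin.≟ t
... | yes refl = inserted
... | no x≢t = subst (Split x) (Fin.punchIn-punchOut x≢t) (old (punchOut x≢t))

module Insertion {n} (T : Tournament (suc n)) (x : Fin (suc n)) {ρ : Fin n → ℕ}
  (paving : IsPavingRanking (delete T x) ρ) (p : ℕ) (p≤n : p ≤ n)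
  (x-target-unique : AtMostOne (λ v → ρ v < p × E T x (punchIn x v)))
  (x-source-unique : AtMostOne (λ v → p ≤ ρ v × E T (punchIn x v) x))
  (x-sole-target : ∀ a → p ≤ ρ a → E T (punchIn x a) x → ∀ b → ¬ Back (delete T x) ρ a b)
  (x-sole-source : ∀ b → ρ b < p → E T x (punchIn x b) → NoLaterBackSource (delete T x) ρ b)
  (previous-not-from-x : ∀ v → suc (ρ v) ≡ p → ¬ E T x (punchIn x v))
  (next-not-to-x : ∀ v → ρ v ≡ p → ¬ E T (punchIn x v) x)
  where

  private
    module S = IsPavingRanking paving

  ρ⁺ : Fin (suc n) → ℕ
  ρ⁺ = insertAt (bump p ∘ ρ) x p

  private
    ρ⁺-x : ρ⁺ x ≡ p
    ρ⁺-x = insertAt-lookup (bump p ∘ ρ) x p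

    ρ⁺-old : ∀ v → ρ⁺ (punchIn x v) ≡ bump p (ρ v)
    ρ⁺-old = insertAt-punchIn (bump p ∘ ρ) x p

    old-old : ∀ {a b} → Back T ρ⁺ (punchIn x a) (punchIn x b) → Back (delete T x) ρ a b
    old-old {a} {b} (l , e) = bump-reflects-< (subst₂ _<_ (ρ⁺-old b) (ρ⁺-old a) l) , e

    old-x : ∀ {a} → Back T ρ⁺ (punchIn x a) x → p ≤ ρ a × E T (punchIn x a) x
    old-x {a} (l , e) = bump-above (subst₂ _<_ ρ⁺-x (ρ⁺-old a) l) , e

    x-old : ∀ {b} → Back T ρ⁺ x (punchIn x b) → ρ b < p × E T x (punchIn x b)
    x-old {b} (l , e) = bump-below (subst₂ _<_ (ρ⁺-old b) ρ⁺-x l) , e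

    bounded : ∀ t → ρ⁺ t < suc n
    bounded t with split x t
    ... | inserted = subst (_< suc n) (sym ρ⁺-x) (s≤s p≤n)
    ... | old v = subst (_< suc n) (sym (ρ⁺-old v)) (bump-bounded p≤n (S.bounded v))

    injective : ∀ {a b} → ρ⁺ a ≡ ρ⁺ b → a ≡ b
    injective {a} {b} eq with split x a | split x b
    ... | inserted | inserted = refl
    ... | inserted | old v = ⊥-elim (bump≢p (ρ v) (trans (sym (ρ⁺-old v)) (trans (sym eq) ρ⁺-x)))
    ... | old u | inserted = ⊥-elim (bump≢p (ρ u) (trans (sym (ρ⁺-old u)) (trans eq ρ⁺-x)))
    ... | old u | old v =
          cong (punchIn x) (S.injective (bump-injective (trans (sym (ρ⁺-old u)) (trans eq (ρ⁺-old v)))))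

    consecutive : ∀ a b → ρ⁺ b ≡ suc (ρ⁺ a) → ¬ E T b a
    consecutive a b eq with split x a | split x b
    ... | inserted | inserted = irrefl T x
    ... | inserted | old v =
          next-not-to-x v (bump-just-above (trans (sym (ρ⁺-old v)) (trans eq (cong suc ρ⁺-x))))
    ... | old u | inserted =
          previous-not-from-x u (bump-just-below (trans (cong suc (sym (ρ⁺-old u))) (trans (sym eq) ρ⁺-x)))
    ... | old u | old v =
          S.back-not-consecutive u v
            (bump-reflects-consecutive (trans (sym (ρ⁺-old v)) (trans eq (cong suc (ρ⁺-old u)))))

    targets : ∀ a → AtMostOne (Back T ρ⁺ a)
    targets a b₁ b₂ ab₁ ab₂ with split x a | split x b₁ | split x b₂
    ... | _ | inserted | inserted = refl
    ... | inserted | inserted | old _ = ⊥-elim (irrefl T x (proj₂ ab₁))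
    ... | inserted | old _ | inserted = ⊥-elim (irrefl T x (proj₂ ab₂))
    ... | inserted | old v₁ | old v₂ = cong (punchIn x) (x-target-unique v₁ v₂ (x-old ab₁) (x-old ab₂))
    ... | old u | inserted | old v = ⊥-elim (x-sole-target u (proj₁ (old-x ab₁)) (proj₂ ab₁) v (old-old ab₂))
    ... | old u | old v | inserted = ⊥-elim (x-sole-target u (proj₁ (old-x ab₂)) (proj₂ ab₂) v (old-old ab₁))
    ... | old u | old v₁ | old v₂ = cong (punchIn x) (S.back-target-unique u v₁ v₂ (old-old ab₁) (old-old ab₂))

    sources : ∀ b → AtMostOne (λ a → Back T ρ⁺ a b)
    sources b a₁ a₂ a₁b a₂b with split x b | split x a₁ | split x a₂
    ... | _ | inserted | inserted = refl
    ... | inserted | inserted | old _ = ⊥-elim (irrefl T x (proj₂ a₁b))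
    ... | inserted | old _ | inserted = ⊥-elim (irrefl T x (proj₂ a₂b))
    ... | inserted | old u₁ | old u₂ = cong (punchIn x) (x-source-unique u₁ u₂ (old-x a₁b) (old-x a₂b))
    ... | old v | inserted | old u = ⊥-elim (x-sole-source v (proj₁ (x-old a₁b)) (proj₂ a₁b) u (old-old a₂b))
    ... | old v | old u | inserted = ⊥-elim (x-sole-source v (proj₁ (x-old a₂b)) (proj₂ a₂b) u (old-old a₁b))
    ... | old v | old u₁ | old u₂ = cong (punchIn x) (S.back-source-unique v u₁ u₂ (old-old a₁b) (old-old a₂b))

  ρ⁺-paving : IsPavingRanking T ρ⁺
  ρ⁺-paving = record
    { isRanking = record { bounded = bounded ; injective = injective }
    ; back-not-consecutive = consecutive
    ; back-target-unique = targets
    ; back-source-unique = sources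
    }

insert-last : ∀ {n} (T : Tournament (suc n)) x {ρ} → IsPavingRanking (delete T x) ρ →
              AtMostOne (λ v → E T x (punchIn x v)) →
              (∀ v → E T x (punchIn x v) → NoLaterBackSource (delete T x) ρ v × suc (ρ v) ≢ n) →
              IsPaving T
insert-last {n} T x {ρ} paving x-unique x-targets =
  ranking⇒paving (Insertion.ρ⁺-paving T x paving n ℕ.≤-refl
    (λ v₁ v₂ (_ , xv₁) (_ , xv₂) → x-unique v₁ v₂ xv₁ xv₂)
    (λ v _ (n≤ρv , _) → contradiction n≤ρv (ℕ.<⇒≱ (bounded v)))
    (λ a n≤ρa → contradiction n≤ρa (ℕ.<⇒≱ (bounded a)))
    (λ b _ xb → proj₁ (x-targets b xb))
    (λ v eq xv → proj₂ (x-targets v xv) eq)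
    (λ v eq → contradiction eq (ℕ.<⇒≢ (bounded v))))
  where open IsPavingRanking paving

insert-before-last : ∀ {n} (T : Tournament (suc n)) x {ρ} → IsPavingRanking (delete T x) ρ →
                     ∀ {w} → suc (ρ w) ≡ n → E T x (punchIn x w) → (∀ v → E T x (punchIn x v) → v ≡ w) →
                     IsPaving T
insert-before-last {n} T x {ρ} paving {w} w-last xw only-w =
  ranking⇒paving (Insertion.ρ⁺-paving T x paving (ρ w) (ℕ.<⇒≤ (bounded w))
    (λ _ _ (l , xv) _ → ⊥-elim (not-from-x-before l xv))
    (λ _ _ (l , vx) _ → ⊥-elim (not-to-x-after l vx))
    (λ _ l ax → ⊥-elim (not-to-x-after l ax))
    (λ _ l xb → ⊥-elim (not-from-x-before l xb))
    (λ _ eq → not-from-x-before (ℕ.≤-reflexive eq))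
    (λ _ eq → not-to-x-after (ℕ.≤-reflexive (sym eq))))
  where
  open IsPavingRanking paving
  not-from-x-before : ∀ {v} → ρ v < ρ w → ¬ E T x (punchIn x v)
  not-from-x-before l xv with only-w _ xv
  ... | refl = ℕ.<-irrefl refl l
  not-to-x-after : ∀ {v} → ρ w ≤ ρ v → ¬ E T (punchIn x v) x
  not-to-x-after {v} l vx with injective (ℕ.≤-antisym (ℕ.≤-pred (subst (ρ v <_) (sym w-last) (bounded v))) l)
  ... | refl = asym T _ _ xw vx

-- Rearranging a block of consecutive ranks

-- The i-th vertex of a block of L consecutive vertices moves to offset π i; es lists the edges among
-- them, indexed by their old offsets.
record SingleBackEdge {L} (π : Fin L → Fin L) (es : List (Fin L × Fin L)) (first last : Fin L) : Set where
  field
    injective      : ∀ i j → π i ≡ π j → i ≡ j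
    first-to-front : toℕ (π first) ≡ 0
    last-to-back   : suc (toℕ (π last)) ≡ L
    long           : 3 ≤ L
    complete       : ∀ i j → i ≢ j → (i , j) ∈ es ⊎ (j , i) ∈ es
    only-back-edge : ∀ i j → (i , j) ∈ es → toℕ (π j) < toℕ (π i) → i ≡ last × j ≡ first

singleBackEdge? : ∀ {L} π es first last → Dec (SingleBackEdge {L} π es first last)
singleBackEdge? {L} π es first last =
  map′ (λ (a , b , c , d , e , f) → record
         { injective = a ; first-to-front = b ; last-to-back = c ; long = d ; complete = e ; only-back-edge = f })
       (λ r → let open SingleBackEdge r in
         injective , first-to-front , last-to-back , long , complete , only-back-edge)
       (      all₂ (λ i j → π i Fin.≟ π j →-dec i Fin.≟ j)
        ×-dec toℕ (π first) ℕ.≟ 0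
        ×-dec suc (toℕ (π last)) ℕ.≟ L
        ×-dec 3 ℕ.≤? L
        ×-dec all₂ (λ i j → ¬? (i Fin.≟ j) →-dec ((i , j) ∈? es ⊎-dec (j , i) ∈? es))
        ×-dec all₂ (λ i j → (i , j) ∈? es →-dec toℕ (π j) <? toℕ (π i) →-dec i Fin.≟ last ×-dec j Fin.≟ first))
  where
  all₂ : {P : Fin L → Fin L → Set} → (∀ i j → Dec (P i j)) → Dec (∀ i j → P i j)
  all₂ P? = Fin.all? λ i → Fin.all? (P? i)
  _∈?_ : ∀ e es → Dec (e ∈ es)
  e ∈? es = any? (≡-dec Fin._≟_ Fin._≟_ e) es

module Rearrangement {n} {S : Tournament n} {ρ : Fin n → ℕ} (paving : IsPavingRanking S ρ)
  {L} (s : ℕ) (V : Fin L → Fin n) (V-rank : ∀ i → ρ (V i) ≡ toℕ i + s)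
  {π : Fin L → Fin L} {es : List (Fin L × Fin L)} {first last : Fin L}
  (arrangement : SingleBackEdge π es first last)
  (es-edges : All (λ (i , j) → E S (V i) (V j)) es)
  (last-no-target-before : ∀ b → ρ b < s → ¬ E S (V last) b)
  (first-no-source-after : ∀ c → L + s ≤ ρ c → ¬ E S c (V first))
  (first-not-to-previous : ∀ b → suc (ρ b) ≡ s → ¬ E S (V first) b)
  (next-not-to-last : ∀ c → ρ c ≡ L + s → ¬ E S c (V last))
  where

  private
    module S = IsPavingRanking paving
    module A = SingleBackEdge arrangement

    data Position (r : ℕ) : Set where
      before : r < s → Position r
      inside : (i : Fin L) → r ≡ toℕ i + s → Position r
      after  : L + s ≤ r → Position r

    position : ∀ r → Position r
    position r with r <? s
    ... | yes r<s = before r<s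
    ... | no r≮s with r <? L + s
    ...   | no r≮L+s = after (ℕ.≮⇒≥ r≮L+s)
    ...   | yes r<L+s = inside (fromℕ< offset<L) (sym (trans (cong (_+ s) (Fin.toℕ-fromℕ< offset<L)) r-s+s≡r))
      where
      r-s+s≡r : r ∸ s + s ≡ r
      r-s+s≡r = ℕ.m∸n+n≡m (ℕ.≮⇒≥ r≮s)
      offset<L : r ∸ s < L
      offset<L = ℕ.+-cancelʳ-< s (r ∸ s) L (subst (_< L + s) (sym r-s+s≡r) r<L+s)

    relocate : ∀ {r} → Position r → ℕ
    relocate {r} (before _) = r
    relocate (inside i _) = toℕ (π i) + s
    relocate {r} (after _) = r

  ρ′ : Fin n → ℕ
  ρ′ v = relocate (position (ρ v))

  private
    data Place (v : Fin n) : Set where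
      before : ρ v < s → ρ′ v ≡ ρ v → Place v
      inside : (i : Fin L) → v ≡ V i → ρ′ v ≡ toℕ (π i) + s → Place v
      after  : L + s ≤ ρ v → ρ′ v ≡ ρ v → Place v

    place : ∀ v → Place v
    place v = classify (position (ρ v)) refl
      where
      classify : (p : Position (ρ v)) → ρ′ v ≡ relocate p → Place v
      classify (before l) eq = before l eq
      classify (inside i r) eq = inside i (S.injective (trans r (sym (V-rank i)))) eq
      classify (after h) eq = after h eq

    Outside : ∀ {v} → Place v → Set
    Outside (inside _ _ _) = ⊥
    Outside _ = ⊤

    at-least-s : ∀ (k : Fin L) → s ≤ toℕ k + s
    at-least-s k = ℕ.m≤n+m s (toℕ k)

    below-L+s : ∀ (k : Fin L) → toℕ k + s < L + s
    below-L+s k = ℕ.+-monoˡ-< s (Fin.toℕ<n k)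

    below-block : ∀ {r} (k : Fin L) → r < s → r < toℕ k + s
    below-block k r<s = ℕ.<-≤-trans r<s (at-least-s k)

    above-block : ∀ {r} (k : Fin L) → L + s ≤ r → toℕ k + s < r
    above-block k h = ℕ.<-≤-trans (below-L+s k) h

    V-injective : ∀ {i j} → V i ≡ V j → i ≡ j
    V-injective {i} {j} eq =
      Fin.toℕ-injective (ℕ.+-cancelʳ-≡ s _ _ (trans (sym (V-rank i)) (trans (cong ρ eq) (V-rank j))))

    ρ′-V : ∀ i → ρ′ (V i) ≡ toℕ (π i) + s
    ρ′-V i with place (V i)
    ... | before l _ = ⊥-elim (ℕ.<-irrefl (V-rank i) (below-block i l))
    ... | inside j eq e = trans e (cong (λ k → toℕ (π k) + s) (sym (V-injective eq)))
    ... | after h _ = ⊥-elim (ℕ.<-irrefl (sym (V-rank i)) (above-block i h))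

    edge-listed : ∀ {i j} → E S (V i) (V j) → (i , j) ∈ es
    edge-listed {i} {j} e with i Fin.≟ j
    ... | yes refl = ⊥-elim (irrefl S _ e)
    ... | no i≢j with A.complete i j i≢j
    ...   | inj₁ listed = listed
    ...   | inj₂ reversed = ⊥-elim (asym S _ _ e (All.lookup es-edges reversed))

    internal-back : ∀ {i j} → Back S ρ′ (V i) (V j) → i ≡ last × j ≡ first
    internal-back {i} {j} (l , e) =
      A.only-back-edge i j (edge-listed e) (ℕ.+-cancelʳ-< s _ _ (subst₂ _<_ (ρ′-V j) (ρ′-V i) l))

    kept : ∀ {a b} (pa : Place a) (pb : Place b) → Outside pa ⊎ Outside pb → ρ′ b < ρ′ a → ρ b < ρ a
    kept (before _ ea) (before _ eb) _ l = subst₂ _<_ eb ea l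
    kept (before la ea) (inside j _ eb) _ l =
      ⊥-elim (ℕ.<-asym (subst₂ _<_ (sym ea) (sym eb) (below-block (π j) la)) l)
    kept (before la ea) (after hb eb) _ l =
      ⊥-elim (ℕ.<-asym (subst₂ _<_ (sym ea) (sym eb) (ℕ.<-≤-trans la (ℕ.≤-trans (ℕ.m≤n+m s L) hb))) l)
    kept (inside i refl _) (before lb _) _ _ = subst (ρ _ <_) (sym (V-rank i)) (below-block i lb)
    kept (inside _ _ _) (inside _ _ _) (inj₁ ())
    kept (inside _ _ _) (inside _ _ _) (inj₂ ())
    kept (inside i _ ea) (after hb eb) _ l =
      ⊥-elim (ℕ.<-asym (subst₂ _<_ (sym ea) (sym eb) (above-block (π i) hb)) l)
    kept (after ha _) (before lb _) _ _ = ℕ.<-≤-trans lb (ℕ.≤-trans (ℕ.m≤n+m s L) ha)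
    kept (after ha _) (inside j refl _) _ _ = subst (_< ρ _) (sym (V-rank j)) (above-block j ha)
    kept (after _ ea) (after _ eb) _ l = subst₂ _<_ eb ea l

    back-kept : ∀ {a b} (pa : Place a) (pb : Place b) → Outside pa ⊎ Outside pb → Back S ρ′ a b → Back S ρ a b
    back-kept pa pb outside (l , e) = kept pa pb outside l , e

    last-not-next-to-first : toℕ (π last) + s ≢ suc (toℕ (π first) + s)
    last-not-next-to-first eq = ℕ.<-irrefl refl (subst (3 ≤_) L≡2 A.long)
      where
      L≡2 : L ≡ 2
      L≡2 = trans (sym A.last-to-back)
              (cong suc (ℕ.+-cancelʳ-≡ s _ 1 (trans eq (cong (λ k → suc (k + s)) A.first-to-front))))

    block-start : ∀ {r} j → r < s → toℕ (π j) + s ≡ suc r → j ≡ first × suc r ≡ s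
    block-start {r} j r<s eq = j≡first , 1+r≡s
      where
      1+r≡s : suc r ≡ s
      1+r≡s = ℕ.≤-antisym r<s (subst (s ≤_) eq (at-least-s (π j)))
      j≡first : j ≡ first
      j≡first = A.injective j first (Fin.toℕ-injective
        (trans (ℕ.+-cancelʳ-≡ s _ 0 (trans eq 1+r≡s)) (sym A.first-to-front)))

    block-end : ∀ {r} i → L + s ≤ r → r ≡ suc (toℕ (π i) + s) → i ≡ last × r ≡ L + s
    block-end {r} i h eq = i≡last , r≡L+s
      where
      r≡L+s : r ≡ L + s
      r≡L+s = ℕ.≤-antisym (subst (_≤ _) (sym eq) (below-L+s (π i))) h
      i≡last : i ≡ last
      i≡last = A.injective i last (Fin.toℕ-injective (ℕ.suc-injective
        (trans (ℕ.+-cancelʳ-≡ s _ _ (trans (sym eq) r≡L+s)) (sym A.last-to-back))))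

    bounded : ∀ v → ρ′ v < n
    bounded v with place v
    ... | before _ e = subst (_< n) (sym e) (S.bounded v)
    ... | inside i refl e = subst (_< n) (trans (V-rank (π i)) (sym e)) (S.bounded (V (π i)))
    ... | after _ e = subst (_< n) (sym e) (S.bounded v)

    injective : ∀ {a b} → ρ′ a ≡ ρ′ b → a ≡ b
    injective {a} {b} eq with place a | place b
    ... | inside i refl ea | inside j refl eb =
          cong V (A.injective i j (Fin.toℕ-injective (ℕ.+-cancelʳ-≡ s _ _ (trans (sym ea) (trans eq eb)))))
    ... | before la ea | inside j refl eb =
          ⊥-elim (ℕ.<-irrefl (trans (sym ea) (trans eq eb)) (below-block (π j) la))
    ... | inside i refl ea | before lb eb =
          ⊥-elim (ℕ.<-irrefl (trans (sym eb) (trans (sym eq) ea)) (below-block (π i) lb))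
    ... | after ha ea | inside j refl eb =
          ⊥-elim (ℕ.<-irrefl (trans (sym eb) (trans (sym eq) ea)) (above-block (π j) ha))
    ... | inside i refl ea | after hb eb =
          ⊥-elim (ℕ.<-irrefl (trans (sym ea) (trans eq eb)) (above-block (π i) hb))
    ... | before _ ea | before _ eb = S.injective (trans (sym ea) (trans eq eb))
    ... | before _ ea | after _ eb = S.injective (trans (sym ea) (trans eq eb))
    ... | after _ ea | before _ eb = S.injective (trans (sym ea) (trans eq eb))
    ... | after _ ea | after _ eb = S.injective (trans (sym ea) (trans eq eb))

    consecutive : ∀ a b → ρ′ b ≡ suc (ρ′ a) → ¬ E S b a
    consecutive a b eq with place a | place b
    ... | inside i refl ea | inside j refl eb = λ ba →
          let j≡last , i≡first = internal-back (ℕ.≤-reflexive (sym eq) , ba)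
          in last-not-next-to-first (subst₂ (λ j i → toℕ (π j) + s ≡ suc (toℕ (π i) + s)) j≡last i≡first
               (trans (sym eb) (trans eq (cong suc ea))))
    ... | before la ea | inside j refl eb = λ ba →
          let j≡first , 1+ρa≡s = block-start j la (trans (sym eb) (trans eq (cong suc ea)))
          in first-not-to-previous a 1+ρa≡s (subst (λ k → E S (V k) a) j≡first ba)
    ... | after ha ea | inside j refl eb =
          ⊥-elim (ℕ.<-irrefl (trans (sym eb) (trans eq (cong suc ea))) (ℕ.<-trans (below-L+s (π j)) (s≤s ha)))
    ... | inside i refl ea | before lb eb =
          ⊥-elim (ℕ.<-irrefl (trans (sym eb) (trans eq (cong suc ea))) (ℕ.m<n⇒m<1+n (below-block (π i) lb)))
    ... | inside i refl ea | after hb eb = λ ba →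
          let i≡last , ρb≡L+s = block-end i hb (trans (sym eb) (trans eq (cong suc ea)))
          in next-not-to-last b ρb≡L+s (subst (λ k → E S b (V k)) i≡last ba)
    ... | before _ ea | before _ eb = S.back-not-consecutive a b (trans (sym eb) (trans eq (cong suc ea)))
    ... | before _ ea | after _ eb = S.back-not-consecutive a b (trans (sym eb) (trans eq (cong suc ea)))
    ... | after _ ea | before _ eb = S.back-not-consecutive a b (trans (sym eb) (trans eq (cong suc ea)))
    ... | after _ ea | after _ eb = S.back-not-consecutive a b (trans (sym eb) (trans eq (cong suc ea)))

    after-not-earlier : ∀ {b} i → L + s ≤ ρ b → ρ′ b ≡ ρ b → ¬ ρ′ b < ρ′ (V i)
    after-not-earlier i h eb l = ℕ.<-asym (subst₂ _<_ (sym (ρ′-V i)) (sym eb) (above-block (π i) h)) l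

    before-not-later : ∀ {a} j → ρ a < s → ρ′ a ≡ ρ a → ¬ ρ′ (V j) < ρ′ a
    before-not-later j l ea l′ = ℕ.<-asym (subst₂ _<_ (sym ea) (sym (ρ′-V j)) (below-block (π j) l)) l′

    targets : ∀ a → AtMostOne (Back S ρ′ a)
    targets a b₁ b₂ ab₁ ab₂ with place a | place b₁ | place b₂
    ... | inside i refl _ | inside j₁ refl _ | inside j₂ refl _ =
          cong V (trans (proj₂ (internal-back ab₁)) (sym (proj₂ (internal-back ab₂))))
    ... | inside i refl _ | inside j refl _ | before l _ =
          ⊥-elim (last-no-target-before b₂ l (subst (λ k → E S (V k) b₂) (proj₁ (internal-back ab₁)) (proj₂ ab₂)))
    ... | inside i refl _ | before l _ | inside j refl _ =
          ⊥-elim (last-no-target-before b₁ l (subst (λ k → E S (V k) b₁) (proj₁ (internal-back ab₂)) (proj₂ ab₁)))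
    ... | inside i refl _ | after h eb | _ = ⊥-elim (after-not-earlier i h eb (proj₁ ab₁))
    ... | inside i refl _ | _ | after h eb = ⊥-elim (after-not-earlier i h eb (proj₁ ab₂))
    ... | pa@(inside _ refl _) | pb₁@(before _ _) | pb₂@(before _ _) =
          S.back-target-unique _ _ _ (back-kept pa pb₁ (inj₂ tt) ab₁) (back-kept pa pb₂ (inj₂ tt) ab₂)
    ... | pa@(before _ _) | pb₁ | pb₂ =
          S.back-target-unique _ _ _ (back-kept pa pb₁ (inj₁ tt) ab₁) (back-kept pa pb₂ (inj₁ tt) ab₂)
    ... | pa@(after _ _) | pb₁ | pb₂ =
          S.back-target-unique _ _ _ (back-kept pa pb₁ (inj₁ tt) ab₁) (back-kept pa pb₂ (inj₁ tt) ab₂)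

    sources : ∀ b → AtMostOne (λ a → Back S ρ′ a b)
    sources b a₁ a₂ a₁b a₂b with place b | place a₁ | place a₂
    ... | inside j refl _ | inside i₁ refl _ | inside i₂ refl _ =
          cong V (trans (proj₁ (internal-back a₁b)) (sym (proj₁ (internal-back a₂b))))
    ... | inside j refl _ | inside i refl _ | after h _ =
          ⊥-elim (first-no-source-after a₂ h (subst (λ k → E S a₂ (V k)) (proj₂ (internal-back a₁b)) (proj₂ a₂b)))
    ... | inside j refl _ | after h _ | inside i refl _ =
          ⊥-elim (first-no-source-after a₁ h (subst (λ k → E S a₁ (V k)) (proj₂ (internal-back a₂b)) (proj₂ a₁b)))
    ... | inside j refl _ | before l ea | _ = ⊥-elim (before-not-later j l ea (proj₁ a₁b))
    ... | inside j refl _ | _ | before l ea = ⊥-elim (before-not-later j l ea (proj₁ a₂b))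
    ... | pb@(inside _ refl _) | pa₁@(after _ _) | pa₂@(after _ _) =
          S.back-source-unique _ _ _ (back-kept pa₁ pb (inj₁ tt) a₁b) (back-kept pa₂ pb (inj₁ tt) a₂b)
    ... | pb@(before _ _) | pa₁ | pa₂ =
          S.back-source-unique _ _ _ (back-kept pa₁ pb (inj₂ tt) a₁b) (back-kept pa₂ pb (inj₂ tt) a₂b)
    ... | pb@(after _ _) | pa₁ | pa₂ =
          S.back-source-unique _ _ _ (back-kept pa₁ pb (inj₂ tt) a₁b) (back-kept pa₂ pb (inj₂ tt) a₂b)

  ρ′-paving : IsPavingRanking S ρ′
  ρ′-paving = record
    { isRanking = record { bounded = bounded ; injective = injective }
    ; back-not-consecutive = consecutive
    ; back-target-unique = targets
    ; back-source-unique = sources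
    }

  ρ′-no-later : ∀ i → i ≢ first → (∀ c → L + s ≤ ρ c → ¬ E S c (V i)) → NoLaterBackSource S ρ′ (V i)
  ρ′-no-later i i≢first none-after c (l , e) with place c
  ... | before lc ec = before-not-later i lc ec l
  ... | inside j refl _ = i≢first (proj₂ (internal-back (l , e)))
  ... | after hc _ = none-after c hc e

-- The cyclic triangle

ClearedRanking : ∀ {n} → Tournament n → Fin n → Set
ClearedRanking S w = ∃ λ ρ → IsPavingRanking S ρ × NoLaterBackSource S ρ w

cyclic-triangle : List (Fin 3 × Fin 3)
cyclic-triangle = (0F , 1F) ∷ (1F , 2F) ∷ (2F , 0F) ∷ []

module Triangle {n} {S : Tournament n} (free : Δ122-free S) {ρ} (paving : IsPavingRanking S ρ)
  {w y u : Fin n} {k : ℕ} (w-rank : ρ w ≡ k) (y-rank : ρ y ≡ 1 + k) (u-rank : ρ u ≡ 2 + k)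
  (wy : E S w y) (yu : E S y u) (uw : E S u w)
  (two-path-unique : AtMostOne (λ z → E S w z × E S z u))
  where

  open IsPavingRanking paving

  private
    w<y : ρ w < ρ y
    w<y = subst₂ _<_ (sym w-rank) (sym y-rank) ℕ.≤-refl
    y<u : ρ y < ρ u
    y<u = subst₂ _<_ (sym y-rank) (sym u-rank) ℕ.≤-refl
    w<u : ρ w < ρ u
    w<u = ℕ.<-trans w<y y<u

    before-y : ∀ {a} → ρ a < k → ρ a < ρ y
    before-y {a} l = subst (ρ a <_) (sym y-rank) (ℕ.m<n⇒m<1+n l)
    after-u : ∀ {c} → 2 + k < ρ c → ρ u < ρ c
    after-u {c} l = subst (_< ρ c) (sym u-rank) l

  w-sole-source : ∀ c → Back S ρ c w → c ≡ u
  w-sole-source c cw = back-source-unique w c u cw (w<u , uw)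

  u-sole-target : ∀ b → Back S ρ u b → b ≡ w
  u-sole-target b ub = back-target-unique u b w ub (w<u , uw)

  w-no-source-after : ∀ c → 2 + k < ρ c → ¬ E S c w
  w-no-source-after c l cw with w-sole-source c (ℕ.<-trans w<u (after-u l) , cw)
  ... | refl = ℕ.<-irrefl refl (after-u l)

  u-not-to-previous : ∀ b → suc (ρ b) ≡ k → ¬ E S u b
  u-not-to-previous b eq ub with u-sole-target b (ℕ.<-trans (before-y (ℕ.≤-reflexive eq)) y<u , ub)
  ... | refl = ℕ.<-irrefl (trans w-rank (sym eq)) (ℕ.n<1+n _)

  w-no-target-before : ∀ a → ρ a < k → ¬ E S w a
  w-no-target-before a l wa with two-path-unique a y (wa , au) (wy , yu)
    where
    au : E S a u
    au = forward S ρ (ℕ.<-trans (before-y l) y<u) λ ua →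
           ℕ.<-irrefl (cong ρ (u-sole-target a (ℕ.<-trans (before-y l) y<u , ua))) (subst (ρ a <_) (sym w-rank) l)
  ... | refl = ℕ.<-irrefl refl (before-y l)

  u-no-source-after : ∀ q → 2 + k < ρ q → ¬ E S q u
  u-no-source-after q l qu with two-path-unique q y (wq , qu) (wy , yu)
    where
    wq : E S w q
    wq = forward S ρ (ℕ.<-trans w<u (after-u l)) (w-no-source-after q l)
  ... | refl = ℕ.<-irrefl refl (ℕ.<-trans y<u (after-u l))

  -- Otherwise y, {b, u}, {w, c} span a Δ(1,2,2).
  y-not-target-and-source : ∀ {b c} → Back S ρ y b → Back S ρ c y → ⊥
  y-not-target-and-source {b} {c} (b<y , yb) (y<c , cy) = ℕ.<-irrefl (cong ρ b≡u) (ℕ.<-trans b<y y<u)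
    where
    b<w : ρ b < ρ w
    b<w = ℕ.≤∧≢⇒< (subst (ρ b ≤_) (sym w-rank) (ℕ.≤-pred (subst (ρ b <_) y-rank b<y)))
                   (λ eq → asym S _ _ wy (subst (E S y) (injective eq) yb))
    u<c : ρ u < ρ c
    u<c = ℕ.≤∧≢⇒< (subst (_≤ ρ c) (sym (trans u-rank (cong suc (sym y-rank)))) y<c)
                   (λ eq → asym S _ _ yu (subst (λ v → E S v y) (sym (injective eq)) cy))
    b<c : ρ b < ρ c
    b<c = ℕ.<-trans b<y y<c
    b≡u : b ≡ u
    b≡u = middle-unique S free
            (forward S ρ (ℕ.<-trans w<u u<c) (w-no-source-after c (subst (_< ρ c) u-rank u<c))) wy cy b u
            (yb , forward S ρ b<w (w-no-target-before b (subst (ρ b <_) w-rank b<w)) ,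
                  forward S ρ b<c (λ cb → ℕ.<-irrefl (cong ρ (back-target-unique c b y (b<c , cb) (y<c , cy))) b<y))
            (yu , uw , forward S ρ u<c (u-no-source-after c (subst (_< ρ c) u-rank u<c)))

  private
    triangle-rank : ∀ i → ρ (lookup (w ∷ y ∷ u ∷ []) i) ≡ toℕ i + k
    triangle-rank 0F = w-rank
    triangle-rank 1F = y-rank
    triangle-rank 2F = u-rank

    no-target-before : (∀ b → ¬ Back S ρ y b) → ∀ b → ρ b < k → ¬ E S y b
    no-target-before y-no-target b l yb = y-no-target b (before-y l , yb)

  -- u-w-y, u-w-c-y, y-u-w and y-b-u-w list the new order of a block of consecutive ranks around the
  -- triangle, c being ranked just after u and b just before w.
  u-w-y : (∀ b → ¬ Back S ρ y b) → (∀ c → ρ c ≡ 3 + k → ¬ E S c y) → ClearedRanking S w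
  u-w-y y-no-target next-not-to-y = R.ρ′ , R.ρ′-paving , R.ρ′-no-later 0F (λ ()) w-no-source-after
    where
    module R = Rearrangement paving k (lookup (w ∷ y ∷ u ∷ []))
      triangle-rank
      (from-yes (singleBackEdge? (lookup (1F ∷ 2F ∷ 0F ∷ [])) cyclic-triangle 2F 1F))
      (wy ∷ yu ∷ uw ∷ [])
      (no-target-before y-no-target) u-no-source-after u-not-to-previous next-not-to-y

  u-w-c-y : (∀ b → ¬ Back S ρ y b) → ∀ {c} → ρ c ≡ 3 + k → E S c y → ClearedRanking S w
  u-w-c-y y-no-target {c} c-rank cy =
    R.ρ′ , R.ρ′-paving , R.ρ′-no-later 0F (λ ()) (λ q l → w-no-source-after q (ℕ.<⇒≤ l))
    where
    c-after-u : 2 + k < ρ c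
    c-after-u = ℕ.≤-reflexive (sym c-rank)
    next-not-to-y : ∀ c′ → ρ c′ ≡ 4 + k → ¬ E S c′ y
    next-not-to-y c′ c′-rank c′y
      with back-source-unique y c′ c (y<c′ , c′y) (ℕ.<-trans y<u (after-u c-after-u) , cy)
      where
      y<c′ : ρ y < ρ c′
      y<c′ = ℕ.<-trans y<u (after-u (subst (2 + k <_) (sym c′-rank) (ℕ.m<n⇒m<1+n ℕ.≤-refl)))
    ... | refl = ℕ.<-irrefl (trans (sym c-rank) c′-rank) (ℕ.n<1+n _)
    block-rank : ∀ i → ρ (lookup (w ∷ y ∷ u ∷ c ∷ []) i) ≡ toℕ i + k
    block-rank 0F = w-rank
    block-rank 1F = y-rank
    block-rank 2F = u-rank
    block-rank 3F = c-rank
    module R = Rearrangement paving k (lookup (w ∷ y ∷ u ∷ c ∷ []))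
      block-rank
      (from-yes (singleBackEdge? (lookup (1F ∷ 3F ∷ 0F ∷ 2F ∷ []))
        ((0F , 1F) ∷ (1F , 2F) ∷ (2F , 0F) ∷ (0F , 3F) ∷ (2F , 3F) ∷ (3F , 1F) ∷ []) 2F 1F))
      (wy ∷ yu ∷ uw ∷ forward S ρ (ℕ.<-trans w<u (after-u c-after-u)) (w-no-source-after c c-after-u)
                   ∷ forward S ρ (after-u c-after-u) (u-no-source-after c c-after-u) ∷ cy ∷ [])
      (no-target-before y-no-target)
      (λ q l → u-no-source-after q (ℕ.<⇒≤ l))
      u-not-to-previous next-not-to-y

  y-u-w : ∀ {b₀} → Back S ρ y b₀ → suc (ρ b₀) ≢ k → ClearedRanking S w
  y-u-w {b₀} yb₀ b₀-not-adjacent = R.ρ′ , R.ρ′-paving , R.ρ′-no-later 0F (λ ()) w-no-source-after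
    where
    y-not-to-previous : ∀ b → suc (ρ b) ≡ k → ¬ E S y b
    y-not-to-previous b eq yb with back-target-unique y b b₀ (before-y (ℕ.≤-reflexive eq) , yb) yb₀
    ... | refl = b₀-not-adjacent eq
    module R = Rearrangement paving k (lookup (w ∷ y ∷ u ∷ []))
      triangle-rank
      (from-yes (singleBackEdge? (lookup (2F ∷ 0F ∷ 1F ∷ [])) cyclic-triangle 1F 0F))
      (wy ∷ yu ∷ uw ∷ [])
      w-no-target-before
      (λ c l cy → y-not-target-and-source yb₀ (ℕ.<-trans y<u (after-u l) , cy))
      y-not-to-previous
      (λ c c-rank → w-no-source-after c (ℕ.≤-reflexive (sym c-rank)))

  y-b-u-w : ∀ {b₀} → Back S ρ y b₀ → suc (ρ b₀) ≡ k → ClearedRanking S w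
  y-b-u-w {b₀} yb₀ adjacent =
    R.ρ′ , R.ρ′-paving , R.ρ′-no-later 1F (λ ()) (λ c l → w-no-source-after c (after-block l))
    where
    s : ℕ
    s = ρ b₀
    after-block : ∀ {c} → 4 + s ≤ ρ c → 2 + k < ρ c
    after-block {c} = subst (λ m → 2 + m < ρ c) adjacent
    b₀<k : s < k
    b₀<k = ℕ.≤-reflexive adjacent
    y-not-to-previous : ∀ b → suc (ρ b) ≡ s → ¬ E S y b
    y-not-to-previous b eq yb
      with back-target-unique y b b₀ (before-y (ℕ.<-trans (ℕ.≤-reflexive eq) b₀<k) , yb) yb₀
    ... | refl = ℕ.<-irrefl (sym eq) (ℕ.n<1+n s)
    b₀u : E S b₀ u
    b₀u = forward S ρ (ℕ.<-trans (before-y b₀<k) y<u) λ ub₀ →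
            ℕ.<-irrefl (trans (cong ρ (u-sole-target b₀ (ℕ.<-trans (before-y b₀<k) y<u , ub₀))) w-rank) b₀<k
    block-rank : ∀ i → ρ (lookup (b₀ ∷ w ∷ y ∷ u ∷ []) i) ≡ toℕ i + s
    block-rank 0F = refl
    block-rank 1F = trans w-rank (sym adjacent)
    block-rank 2F = trans y-rank (cong suc (sym adjacent))
    block-rank 3F = trans u-rank (cong (2 +_) (sym adjacent))
    module R = Rearrangement paving s (lookup (b₀ ∷ w ∷ y ∷ u ∷ []))
      block-rank
      (from-yes (singleBackEdge? (lookup (1F ∷ 3F ∷ 0F ∷ 2F ∷ []))
        ((0F , 1F) ∷ (0F , 3F) ∷ (2F , 0F) ∷ (1F , 2F) ∷ (2F , 3F) ∷ (3F , 1F) ∷ []) 2F 1F))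
      (forward S ρ (subst (s <_) (sym w-rank) b₀<k) (w-no-target-before b₀ b₀<k)
        ∷ b₀u ∷ proj₂ yb₀ ∷ wy ∷ yu ∷ uw ∷ [])
      (λ b l → w-no-target-before b (ℕ.<-trans l b₀<k))
      (λ c l cy → y-not-target-and-source yb₀ (ℕ.<-trans y<u (after-u (after-block l)) , cy))
      y-not-to-previous
      (λ c c-rank → w-no-source-after c (after-block (ℕ.≤-reflexive (sym c-rank))))

  rerank : ClearedRanking S w
  rerank with Fin.any? (back? S ρ y)
  ... | yes (b₀ , yb₀) with suc (ρ b₀) ℕ.≟ k
  ...   | yes adjacent = y-b-u-w yb₀ adjacent
  ...   | no not-adjacent = y-u-w yb₀ not-adjacent
  rerank | no no-target with Fin.any? (λ c → (ρ c ℕ.≟ 3 + k) ×-dec E? S c y)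
  ...   | yes (c , c-rank , cy) = u-w-c-y (λ b yb → no-target (b , yb)) c-rank cy
  ...   | no none = u-w-y (λ b yb → no-target (b , yb)) (λ c c-rank cy → none (c , c-rank , cy))

-- Extending a paving ranking of T ∖ x

clear-later-back-source : ∀ {n} {S : Tournament n} → Δ122-free S → ∀ {ρ} → IsPavingRanking S ρ → ∀ w →
                          (∀ u → E S u w → AtMostOne (λ z → E S w z × E S z u)) → ClearedRanking S w
clear-later-back-source {S = S} free {ρ} paving w two-path-unique with Fin.any? (λ c → back? S ρ c w)
... | no none = ρ , paving , λ c cw → none (c , cw)
... | yes (u , w<u , uw) =
  Triangle.rerank free paving refl y-rank u-rank (proj₁ (between w<y y<u)) (proj₂ (between w<y y<u)) uw
    (two-path-unique u uw)
  where
  open IsPavingRanking paving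
  between : ∀ {z} → ρ w < ρ z → ρ z < ρ u → E S w z × E S z u
  between {z} w<z z<u =
    forward S ρ w<z (λ zw → ℕ.<-irrefl (cong ρ (back-source-unique w z u (w<z , zw) (w<u , uw))) z<u) ,
    forward S ρ z<u (λ uz → ℕ.<-irrefl (cong ρ (back-target-unique u w z (w<u , uw) (z<u , uz))) w<z)
  1+w<u : suc (ρ w) < ρ u
  1+w<u = ℕ.≤∧≢⇒< w<u (λ eq → back-not-consecutive w u (sym eq) uw)
  vertex-at : ∀ r → r < ρ u → ∃ λ v → ρ v ≡ r
  vertex-at r r<u = rank-surjective isRanking r (ℕ.<-trans r<u (bounded u))
  y : Fin _
  y = proj₁ (vertex-at (1 + ρ w) 1+w<u)
  y-rank : ρ y ≡ 1 + ρ w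
  y-rank = proj₂ (vertex-at (1 + ρ w) 1+w<u)
  w<y : ρ w < ρ y
  w<y = ℕ.≤-reflexive (sym y-rank)
  y<u : ρ y < ρ u
  y<u = subst (_< ρ u) (sym y-rank) 1+w<u
  u-rank : ρ u ≡ 2 + ρ w
  u-rank with ρ u ℕ.≟ 2 + ρ w
  ... | yes eq = eq
  ... | no u≢2+w = ⊥-elim (ℕ.<-irrefl (cong ρ y≡z) (subst₂ _<_ (sym y-rank) (sym z-rank) (ℕ.n<1+n _)))
    where
    2+w<u : 2 + ρ w < ρ u
    2+w<u = ℕ.≤∧≢⇒< 1+w<u (λ eq → u≢2+w (sym eq))
    z : Fin _
    z = proj₁ (vertex-at (2 + ρ w) 2+w<u)
    z-rank : ρ z ≡ 2 + ρ w
    z-rank = proj₂ (vertex-at (2 + ρ w) 2+w<u)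
    y≡z : y ≡ z
    y≡z = two-path-unique u uw y z (between w<y y<u)
            (between (subst (ρ w <_) (sym z-rank) (ℕ.m<n⇒m<1+n (ℕ.n<1+n _)))
                     (subst (_< ρ u) (sym z-rank) 2+w<u))

distinct-members⇒2≤length : ∀ {A : Set} {a b : A} {xs : List A} →
                            a ∈ xs → b ∈ xs → a ≢ b → 2 ≤ length xs
distinct-members⇒2≤length {xs = _ ∷ _ ∷ _} _ _ _ = s≤s (s≤s z≤n)
distinct-members⇒2≤length {xs = _ ∷ []} (here refl) (here refl) a≢b = ⊥-elim (a≢b refl)
distinct-members⇒2≤length {xs = _ ∷ []} (there ()) _ _
distinct-members⇒2≤length {xs = _ ∷ []} (here _) (there ()) _

count≤1⇒AtMostOne : ∀ {n} {P : Fin n → Set} (P? : Decidable P) →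
                    length (filter P? (allFin n)) ≤ 1 → AtMostOne P
count≤1⇒AtMostOne P? count≤1 a b pa pb with a Fin.≟ b
... | yes a≡b = a≡b
... | no a≢b = ⊥-elim (ℕ.<-irrefl refl (ℕ.≤-trans
      (distinct-members⇒2≤length (∈-filter⁺ P? (∈-allFin a) pa) (∈-filter⁺ P? (∈-allFin b) pb) a≢b) count≤1))

extend-with-sole-out-neighbour : ∀ {n} (T : Tournament (suc n)) → Δ122-free T → ∀ x {ρ} →
                                 IsPavingRanking (delete T x) ρ → ∀ {w} → E T x (punchIn x w) →
                                 (∀ v → E T x (punchIn x v) → v ≡ w) → IsPaving T
extend-with-sole-out-neighbour {n} T free x paving {w} xw only-w =
  finish (clear-later-back-source (delete-Δ122-free T x free) paving w two-path-unique)
  where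
  to-x : ∀ v → v ≢ w → E T (punchIn x v) x
  to-x v v≢w with total T (punchIn x v) x (Fin.punchInᵢ≢i x v)
  ... | inj₁ vx = vx
  ... | inj₂ xv = ⊥-elim (v≢w (only-w v xv))
  out-of-w : ∀ {v} → E T (punchIn x w) (punchIn x v) → v ≢ w
  out-of-w wv refl = irrefl T _ wv
  two-path-unique : ∀ u → E (delete T x) u w → AtMostOne (λ z → E (delete T x) w z × E (delete T x) z u)
  two-path-unique u uw z₁ z₂ (wz₁ , z₁u) (wz₂ , z₂u) = Fin.punchIn-injective x z₁ z₂
    (middle-unique T free (to-x u (λ { refl → irrefl T _ uw })) uw xw (punchIn x z₁) (punchIn x z₂)
      (wz₁ , z₁u , to-x z₁ (out-of-w wz₁)) (wz₂ , z₂u , to-x z₂ (out-of-w wz₂)))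
  finish : ClearedRanking (delete T x) w → IsPaving T
  finish (ρ′ , paving′ , w-clear) with suc (ρ′ w) ℕ.≟ n
  ... | yes w-last = insert-before-last T x paving′ w-last xw only-w
  ... | no w-not-last = insert-last T x paving′
          (λ v₁ v₂ xv₁ xv₂ → trans (only-w v₁ xv₁) (sym (only-w v₂ xv₂)))
          (λ v xv → subst (λ v → NoLaterBackSource (delete T x) ρ′ v × suc (ρ′ v) ≢ n) (sym (only-w v xv))
                      (w-clear , w-not-last))

extend-outdeg≤1 : ∀ {n} (T : Tournament (suc n)) → Δ122-free T → ∀ x → IsPaving (delete T x) →
                  outdeg T x ≤ 1 → IsPaving T
extend-outdeg≤1 T free x P out≤1 with paving⇒ranking P | Fin.any? (λ v → E? T x (punchIn x v))
... | _ , paving | no none =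
  insert-last T x paving (λ _ _ xv _ → ⊥-elim (none (_ , xv))) (λ v xv → ⊥-elim (none (v , xv)))
... | _ , paving | yes (w , xw) = extend-with-sole-out-neighbour T free x paving xw only-w
  where
  only-w : ∀ v → E T x (punchIn x v) → v ≡ w
  only-w v xv = Fin.punchIn-injective x v w (count≤1⇒AtMostOne (E? T x) out≤1 _ _ xv xw)

corollary4p7 : (n : ℕ) (T : Tournament (suc n)) → Δ122-free T →
    (x : Fin (suc n)) → IsPaving (delete T x) → (outdeg T x ≤ 1 ⊎ indeg T x ≤ 1) →
    IsPaving T
corollary4p7 n T free x P (inj₁ out≤1) = extend-outdeg≤1 T free x P out≤1
-- By definition converse (converse T) has the edges of T, converse (delete T x) those of
-- delete (converse T) x, and outdeg (converse T) x is indeg T x.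
corollary4p7 n T free x P (inj₂ in≤1) =
  converse-paving (converse T)
    (extend-outdeg≤1 (converse T) (converse-Δ122-free T free) x (converse-paving (delete T x) P) in≤1)
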